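{- Let $B=(M,N,E)$ be a bipartite graph of maximum degree $3$ with no vertex of degree one, where $M=\{m_1,\ldots,m_r\}$ and $N=\{n_1,\ldots,n_r\}$ with $r\ge 2$. Define a graph $G$ as follows. Its vertex set consists of new vertices $X_1,\ldots,X_r$, $Y_1,\ldots,Y_r$, a vertex $Z_j$ for each $j$ with $d(n_j)=3$, and a vertex $A_{ij}$ for each edge $m_in_j\in E$. Consider the sets - $K_i=\{X_i\}\cup\{A_{sj}: m_sn_j\in E,\ 1\le s\le i,\ 1\le j\le r\}$ for $1\le i\le r$; - for each $j$ with $d(n_j)=3$: $K_j'=\{Y_j\}\cup\{A_{ij}: m_in_j\in E\}$ and $K_j''=\{Z_j\}\cup\{A_{ij}: m_in_j\in E\}$; - for each $j$ with $d(n_j)=2$: $K_j'=\{Y_j\}\cup\{A_{ij}: m_in_j\in E\}$. Two distinct vertices of $G$ are adjacent if and only if they lie together in at least one of these sets (so these sets are exactly the maximal cliques of $G$). Then $G$ is a rooted directed path graph.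
   Context: A rooted directed tree is a directed tree (a tree each of whose edges is oriented) having exactly one vertex of in-degree zero. A graph $G$ is a rooted directed path graph if it is the intersection graph of a finite family of directed paths in some rooted directed tree, i.e., there is a bijection between the vertices of $G$ and the paths of the family such that two vertices are adjacent iff their paths share a tree vertex. $d(x)$ denotes the degree of $x$ in $B$. -}

module Defs where

open import Data.Nat using (ℕ; zero; suc; _+_; _≤_; _≡ᵇ_)
open import Data.Fin using (Fin; toℕ)
open import Data.Bool using (Bool; true; false; T; if_then_else_)
open import Data.List using (List; []; _∷_; _++_; take; length; map; allFin)
open import Data.Nat.ListAction using (sum)
open import Data.List.Relation.Unary.Linked using (Linked)
open import Data.List.Relation.Unary.Unique.Propositional using (Unique)
open import Data.List.Membership.Propositional using (_∈_)
open import Data.Product using (Σ; ∃; _×_; _,_)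
open import Data.Sum using (_⊎_)
open import Data.Empty using (⊥)
open import Relation.Nullary using (¬_)
open import Relation.Binary.PropositionalEquality using (_≡_; _≢_)
open import Relation.Binary.Construct.Closure.ReflexiveTransitive using (Star)
open import Function.Bundles using (_⇔_)

module Digraph {t : ℕ} (Arc : Fin t → Fin t → Bool) where

  UAdj : Fin t → Fin t → Set
  UAdj u v = T (Arc u v) ⊎ T (Arc v u)

  Connected : Set
  Connected = ∀ u v → Star UAdj u v

  IsCycle : List (Fin t) → Set
  IsCycle vs = (3 ≤ length vs) × Unique vs × Linked UAdj (vs ++ take 1 vs)

  Acyclic : Set
  Acyclic = ∀ vs → ¬ IsCycle vs

  IsDirectedTree : Set
  IsDirectedTree =
    (∀ v → T (Arc v v) → ⊥) ×
    (∀ u v → T (Arc u v) → T (Arc v u) → ⊥) ×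
    Connected × Acyclic

  InDegreeZero : Fin t → Set
  InDegreeZero v = ∀ u → ¬ T (Arc u v)

  IsRootedDirectedTree : Set
  IsRootedDirectedTree =
    IsDirectedTree × Σ (Fin t) (λ root → InDegreeZero root × (∀ v → InDegreeZero v → v ≡ root))

  record DPath : Set where
    field
      verts    : List (Fin t)
      nonempty : verts ≢ []
      directed : Linked (λ u v → T (Arc u v)) verts

  open DPath public

IsRootedDirectedPathGraph : (V : Set) → (V → V → Set) → Set
IsRootedDirectedPathGraph V Adj =
  Σ ℕ λ t → Σ (Fin t → Fin t → Bool) λ Arc →
    let open Digraph Arc in
    IsRootedDirectedTree ×
    Σ (V → DPath) λ P →
      ∀ x y → x ≢ y → (Adj x y ⇔ ∃ λ w → (w ∈ verts (P x)) × (w ∈ verts (P y)))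

-- Bipartite graph B = (M, N, E) with M = {m_1..m_r}, N = {n_1..n_r}:
-- E i j = true  iff  m_i n_j ∈ E.

module Construction (r : ℕ) (E : Fin r → Fin r → Bool) where

  count : (Fin r → Bool) → ℕ
  count f = sum (map (λ k → if f k then 1 else 0) (allFin r))

  degM : Fin r → ℕ
  degM i = count (λ j → E i j)

  degN : Fin r → ℕ
  degN j = count (λ i → E i j)

  data V : Set where
    X : Fin r → V
    Y : Fin r → V
    Z : (j : Fin r) → T (degN j ≡ᵇ 3) → V
    A : (i j : Fin r) → T (E i j) → V

  data InK (i : Fin r) : V → Set where
    kX : InK i (X i)
    kA : ∀ s j (e : T (E s j)) → toℕ s ≤ toℕ i → InK i (A s j e)

  data InK' (j : Fin r) : V → Set where
    k'Y : InK' j (Y j)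
    k'A : ∀ i (e : T (E i j)) → InK' j (A i j e)

  data InK'' (j : Fin r) : V → Set where
    k''Z : (d : T (degN j ≡ᵇ 3)) → InK'' j (Z j d)
    k''A : ∀ i (e : T (E i j)) → InK'' j (A i j e)

  Adj : V → V → Set
  Adj x y = x ≢ y ×
    ( (∃ λ i → InK i x × InK i y)
    ⊎ (∃ λ j → (degN j ≡ 2 ⊎ degN j ≡ 3) × InK' j x × InK' j y)
    ⊎ (∃ λ j → degN j ≡ 3 × InK'' j x × InK'' j y))

-- G is realised on the following rooted tree: a directed path x₀ → x₁ → ⋯ → x_{r−1}
-- (vertex x_i carries the clique K_i), and for every j a child y_j of x_{r−1}
-- (carrying K'_j) with a child z_j of its own (carrying K''_j).  X_i, Y_j and Z_j
-- are the one-vertex paths x_i, y_j, z_j, and A_sj is x_s → ⋯ → x_{r−1} → y_j → z_j.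
-- The paths through any tree vertex are then exactly the members of the clique it
-- carries, so two paths meet iff their vertices lie in a common clique.
module Submission where

open import Defs
open import Data.Nat using (ℕ; zero; suc; _+_; _∸_; _≤_; _<_; z≤n; s≤s; s≤s⁻¹; _≡ᵇ_; _<?_)
open import Data.Nat.Properties
open import Data.Fin using (Fin; zero; suc; toℕ; fromℕ<)
open import Data.Fin.Properties using (toℕ-injective; toℕ<n; toℕ-fromℕ<)
open import Data.Bool using (Bool; true; false; T; if_then_else_)
open import Data.List using (List; []; _∷_; _++_; take; length; map)
open import Data.Nat.ListAction using (sum)
open import Data.List.Properties using (length-++; ++-assoc; ++-identityʳ)
open import Data.List.Relation.Unary.Linked using (Linked; []; [-]; _∷_)
open import Data.List.Relation.Unary.Unique.Propositional using (Unique)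
open import Data.List.Relation.Unary.AllPairs using (_∷_)
open import Data.List.Relation.Unary.All as All using (All; []; _∷_)
open import Data.List.Relation.Unary.Any using (here; there)
open import Data.List.Membership.Propositional using (_∈_)
open import Data.List.Membership.Propositional.Properties
  using (∈-∃++; ∈-map⁺; ∈-map⁻; ∈-allFin; ∈-++⁺ˡ; ∈-++⁺ʳ; ∈-++⁻)
open import Data.List.Relation.Binary.Permutation.Setoid.Properties using (Unique-resp-↭; ++-comm)
open import Data.List.Extrema ≤-totalOrder using (argmax; argmax-sel; f[⊥]≤f[argmax]; f[xs]≤f[argmax])
open import Data.Product using (∃; ∃₂; _×_; _,_; proj₁; proj₂)
open import Data.Sum using (_⊎_; inj₁; inj₂)
open import Data.Empty using (⊥-elim)
open import Relation.Nullary using (yes; no)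
open import Relation.Binary.PropositionalEquality
open import Relation.Binary.Construct.Closure.ReflexiveTransitive using (Star; ε; _◅_; _◅◅_)
import Relation.Binary.Construct.Closure.ReflexiveTransitive as Star
open import Function.Bundles using (_⇔_; mk⇔; Equivalence)

clamp : (n k : ℕ) → Fin (suc n)
clamp zero    k       = zero
clamp (suc n) zero    = zero
clamp (suc n) (suc k) = suc (clamp n k)

toℕ-clamp : ∀ {n k} → k ≤ n → toℕ (clamp n k) ≡ k
toℕ-clamp {zero}  z≤n     = refl
toℕ-clamp {suc n} z≤n     = refl
toℕ-clamp {suc n} (s≤s p) = cong suc (toℕ-clamp p)

1≤sum-indicator : ∀ {A : Set} (f : A → Bool) {xs i} → i ∈ xs → T (f i) →
  1 ≤ sum (map (λ k → if f k then 1 else 0) xs)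
1≤sum-indicator f {x ∷ xs} (here refl) fi with f x
... | true = s≤s z≤n
1≤sum-indicator f {x ∷ xs} (there i∈) fi =
  ≤-trans (1≤sum-indicator f i∈ fi) (m≤n+m _ (if f x then 1 else 0))

module _ {A : Set} {R : A → A → Set} where

  Linked-++⁺ : ∀ xs y ys → Linked R (xs ++ y ∷ []) → Linked R (y ∷ ys) → Linked R (xs ++ y ∷ ys)
  Linked-++⁺ []            y ys _          l = l
  Linked-++⁺ (x ∷ [])      y ys (r ∷ _)    l = r ∷ l
  Linked-++⁺ (x ∷ x' ∷ xs) y ys (r ∷ l₁)   l = r ∷ Linked-++⁺ (x' ∷ xs) y ys l₁ l

  Linked-++⁻ : ∀ xs y ys → Linked R (xs ++ y ∷ ys) → Linked R (xs ++ y ∷ []) × Linked R (y ∷ ys)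
  Linked-++⁻ []            y ys l       = [-] , l
  Linked-++⁻ (x ∷ [])      y ys (r ∷ l) = r ∷ [-] , l
  Linked-++⁻ (x ∷ x' ∷ xs) y ys (r ∷ l) with Linked-++⁻ (x' ∷ xs) y ys l
  ... | l₁ , l₂ = r ∷ l₁ , l₂

  Linked-last : ∀ x xs y → Linked R (x ∷ xs ++ y ∷ []) →
    ∃ λ a → R a y × ((a ≡ x × xs ≡ []) ⊎ a ∈ xs)
  Linked-last x []       y (r ∷ [-]) = x , r , inj₁ (refl , refl)
  Linked-last x (z ∷ zs) y (r ∷ l) with Linked-last z zs y l
  ... | a , ra , inj₁ (refl , refl) = a , ra , inj₂ (here refl)
  ... | a , ra , inj₂ a∈             = a , ra , inj₂ (there a∈)

  rotate-closed-walk : ∀ pre m post →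
    Linked R ((pre ++ m ∷ post) ++ take 1 (pre ++ m ∷ post)) → Linked R (m ∷ (post ++ pre) ++ m ∷ [])
  rotate-closed-walk [] m post l = subst (λ z → Linked R (m ∷ z ++ m ∷ [])) (sym (++-identityʳ post)) l
  rotate-closed-walk (p ∷ pre) m post l =
    subst (λ z → Linked R (m ∷ z)) (sym (++-assoc post (p ∷ pre) (m ∷ [])))
      (Linked-++⁺ (m ∷ post) p (pre ++ m ∷ []) m⋯p p⋯m)
    where
    split = Linked-++⁻ (p ∷ pre) m (post ++ p ∷ [])
              (subst (λ z → Linked R (p ∷ z)) (++-assoc pre (m ∷ post) (p ∷ [])) l)
    p⋯m = proj₁ split
    m⋯p = proj₂ split

  closed-walk-neighbours : ∀ m w → 3 ≤ length (m ∷ w) → Unique (m ∷ w) → Linked R (m ∷ w ++ m ∷ []) →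
    ∃₂ λ a b → a ∈ w × b ∈ w × a ≢ b × R a m × R m b
  closed-walk-neighbours m [] (s≤s ()) _ _
  closed-walk-neighbours m (b ∷ []) (s≤s (s≤s ())) _ _
  closed-walk-neighbours m (b ∷ c ∷ w) _ (_ ∷ (b∉ ∷ _)) (rmb ∷ l) with Linked-last b (c ∷ w) m l
  ... | a , ram , inj₁ (_ , ())
  ... | a , ram , inj₂ a∈ =
    a , b , there a∈ , here refl , (λ a≡b → All.lookup b∉ a∈ (sym a≡b)) , ram , rmb

  -- Rotating the cycle to start at m reduces this to the closed-walk case.
  cycle-neighbours : ∀ vs {m} → 3 ≤ length vs → Unique vs → Linked R (vs ++ take 1 vs) → m ∈ vs →
    ∃₂ λ a b → a ∈ vs × b ∈ vs × a ≢ b × R a m × R m b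
  cycle-neighbours vs {m} len uniq linked m∈ with ∈-∃++ m∈
  ... | pre , post , refl
    with closed-walk-neighbours m (post ++ pre) len′ uniq′ (rotate-closed-walk pre m post linked)
    where
    uniq′ = Unique-resp-↭ (setoid A) (++-comm (setoid A) pre (m ∷ post)) uniq
    len′ : 3 ≤ length (m ∷ post ++ pre)
    len′ = subst (3 ≤_) (trans (length-++ pre) (trans (+-comm (length pre) _)
                   (cong suc (sym (length-++ post))))) len
  ... | a , b , a∈ , b∈ , a≢b , ram , rmb = a , b , back a∈ , back b∈ , a≢b , ram , rmb
    where
    back : ∀ {x} → x ∈ post ++ pre → x ∈ pre ++ m ∷ post
    back x∈ with ∈-++⁻ post x∈
    ... | inj₁ p = ∈-++⁺ʳ pre (there p)
    ... | inj₂ p = ∈-++⁺ˡ p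

-- The tree on {0, …, n} rooted at 0 in which p v is the parent of v > 0.
module ParentTree (n : ℕ) (p : ℕ → ℕ) (p<suc : ∀ v → p (suc v) ≤ v) where

  arcℕ : ℕ → ℕ → Bool
  arcℕ a zero    = false
  arcℕ a (suc b) = a ≡ᵇ p (suc b)

  Arc : Fin (suc n) → Fin (suc n) → Bool
  Arc u v = arcℕ (toℕ u) (toℕ v)

  open Digraph Arc

  ArcChain : List ℕ → Set
  ArcChain = Linked (λ a b → T (arcℕ a b))

  arcℕ⇒≡p : ∀ a b → T (arcℕ a b) → a ≡ p b
  arcℕ⇒≡p a (suc b) h = ≡ᵇ⇒≡ a _ h

  arcℕ⇒< : ∀ a b → T (arcℕ a b) → a < b
  arcℕ⇒< a (suc b) h rewrite arcℕ⇒≡p a (suc b) h = s≤s (p<suc b)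

  ≡p⇒arcℕ : ∀ {a b} → a ≡ p (suc b) → T (arcℕ a (suc b))
  ≡p⇒arcℕ {a} eq = ≡⇒≡ᵇ a _ eq

  parent : Fin n → Fin (suc n)
  parent w = fromℕ< (s≤s (≤-trans (p<suc (toℕ w)) (<⇒≤ (toℕ<n w))))

  parent-arc : ∀ w → T (Arc (parent w) (suc w))
  parent-arc w = ≡p⇒arcℕ (toℕ-fromℕ< _)

  UAdj-sym : ∀ u v → UAdj u v → UAdj v u
  UAdj-sym _ _ (inj₁ h) = inj₂ h
  UAdj-sym _ _ (inj₂ h) = inj₁ h

  path-to-root : ∀ k v → toℕ v ≤ k → Star UAdj v zero
  path-to-root k       zero    _       = ε
  path-to-root (suc k) (suc w) (s≤s w≤k) =
    inj₂ (parent-arc w) ◅ path-to-root k (parent w)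
      (≤-trans (≤-reflexive (toℕ-fromℕ< _)) (≤-trans (p<suc (toℕ w)) w≤k))

  connected : Connected
  connected u v =
    path-to-root n u (s≤s⁻¹ (toℕ<n u)) ◅◅ Star.reverse (λ {u} {v} → UAdj-sym u v) (path-to-root n v (s≤s⁻¹ (toℕ<n v)))

  UAdj-below⇒≡p : ∀ a m → toℕ a ≤ toℕ m → UAdj a m → toℕ a ≡ p (toℕ m)
  UAdj-below⇒≡p a m _   (inj₁ h) = arcℕ⇒≡p (toℕ a) (toℕ m) h
  UAdj-below⇒≡p a m a≤m (inj₂ h) = ⊥-elim (≤⇒≯ a≤m (arcℕ⇒< (toℕ m) (toℕ a) h))

  -- Both cycle-neighbours of a largest vertex m of a cycle are below m, hence both are p m.
  acyclic : Acyclic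
  acyclic [] (() , _)
  acyclic (v ∷ vs) (len , uniq , linked)
    with cycle-neighbours (v ∷ vs) len uniq linked m∈
    where
    m = argmax toℕ v vs
    m∈ : m ∈ v ∷ vs
    m∈ with argmax-sel toℕ v vs
    ... | inj₁ m≡v  = here m≡v
    ... | inj₂ m∈vs = there m∈vs
  ... | a , b , a∈ , b∈ , a≢b , a~m , m~b =
    a≢b (toℕ-injective (trans (UAdj-below⇒≡p a m (≤max a∈) a~m)
                              (sym (UAdj-below⇒≡p b m (≤max b∈) (UAdj-sym m b m~b)))))
    where
    m = argmax toℕ v vs
    ≤max : ∀ {u} → u ∈ v ∷ vs → toℕ u ≤ toℕ m
    ≤max = All.lookup (f[⊥]≤f[argmax] {f = toℕ} v vs ∷ f[xs]≤f[argmax] {f = toℕ} v vs)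

  isRootedDirectedTree : IsRootedDirectedTree
  isRootedDirectedTree =
    ( (λ v h → <-irrefl refl (arcℕ⇒< (toℕ v) (toℕ v) h))
    , (λ u v h h′ → <-asym (arcℕ⇒< (toℕ u) (toℕ v) h) (arcℕ⇒< (toℕ v) (toℕ u) h′))
    , connected , acyclic )
    , zero , (λ u ()) , only-zero
    where
    only-zero : ∀ v → InDegreeZero v → v ≡ zero
    only-zero zero    _     = refl
    only-zero (suc w) no-in = ⊥-elim (no-in (parent w) (parent-arc w))

  toPath : (as : List ℕ) → as ≢ [] → All (_≤ n) as → ArcChain as → DPath
  toPath as as≢[] bounded chain = record
    { verts    = map (clamp n) as
    ; nonempty = map≢[] as as≢[]
    ; directed = map-clamp-Linked bounded chain }
    where
    map≢[] : ∀ as → as ≢ [] → map (clamp n) as ≢ []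
    map≢[] []      as≢[] _  = as≢[] refl
    map≢[] (_ ∷ _) _     ()
    map-clamp-Linked : ∀ {as} → All (_≤ n) as → ArcChain as → Linked (λ u v → T (Arc u v)) (map (clamp n) as)
    map-clamp-Linked _                []      = []
    map-clamp-Linked _                [-]     = [-]
    map-clamp-Linked (a≤n ∷ b≤n ∷ bs) (h ∷ l) =
      subst₂ (λ a b → T (arcℕ a b)) (sym (toℕ-clamp a≤n)) (sym (toℕ-clamp b≤n)) h
      ∷ map-clamp-Linked (b≤n ∷ bs) l

  isRootedDirectedPathGraph : {V : Set} (Adj : V → V → Set) (route : V → List ℕ) →
    (∀ v → route v ≢ []) → (∀ v → All (_≤ n) (route v)) → (∀ v → ArcChain (route v)) →
    (∀ x y → x ≢ y → Adj x y ⇔ (∃ λ a → a ∈ route x × a ∈ route y)) →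
    IsRootedDirectedPathGraph V Adj
  isRootedDirectedPathGraph {V} Adj route route≢[] bounded chain Adj⇔meet =
    suc n , Arc , isRootedDirectedTree , P , λ x y x≢y → mk⇔
      (λ adj → meet⇒ (Equivalence.to (Adj⇔meet x y x≢y) adj))
      (λ m → Equivalence.from (Adj⇔meet x y x≢y) (⇒meet m))
    where
    P : V → DPath
    P v = toPath (route v) (route≢[] v) (bounded v) (chain v)
    ∈-P⁻ : ∀ {v w} → w ∈ verts (P v) → toℕ w ∈ route v
    ∈-P⁻ {v} w∈ with ∈-map⁻ (clamp n) w∈
    ... | a , a∈ , refl = subst (_∈ route v) (sym (toℕ-clamp (All.lookup (bounded v) a∈))) a∈
    meet⇒ : ∀ {x y} → (∃ λ a → a ∈ route x × a ∈ route y) → ∃ λ w → w ∈ verts (P x) × w ∈ verts (P y)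
    meet⇒ (a , ax , ay) = clamp n a , ∈-map⁺ (clamp n) ax , ∈-map⁺ (clamp n) ay
    ⇒meet : ∀ {x y} → (∃ λ w → w ∈ verts (P x) × w ∈ verts (P y)) → ∃ λ a → a ∈ route x × a ∈ route y
    ⇒meet (w , wx , wy) = toℕ w , ∈-P⁻ wx , ∈-P⁻ wy

steps : ℕ → ℕ → List ℕ → List ℕ
steps a zero    tl = tl
steps a (suc k) tl = suc a ∷ steps (suc a) k tl

climb : ℕ → ℕ → List ℕ → List ℕ
climb a k tl = a ∷ steps a k tl

∈-climb⁻ : ∀ a k {tl} {x} → x ∈ climb a k tl → (a ≤ x × x ≤ a + k) ⊎ x ∈ tl
∈-climb⁻ a k       (here refl) = inj₁ (≤-refl , m≤m+n a k)
∈-climb⁻ a zero    (there x∈)  = inj₂ x∈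
∈-climb⁻ a (suc k) {x = x} (there x∈) with ∈-climb⁻ (suc a) k x∈
... | inj₁ (a<x , x≤) = inj₁ (<⇒≤ a<x , subst (x ≤_) (sym (+-suc a k)) x≤)
... | inj₂ x∈tl       = inj₂ x∈tl

∈-climb⁺ : ∀ a k {tl} {x} → a ≤ x → x ≤ a + k → x ∈ climb a k tl
∈-climb⁺ a k a≤x x≤ with m≤n⇒m<n∨m≡n a≤x
... | inj₂ refl = here refl
∈-climb⁺ a zero    a≤x x≤ | inj₁ a<x = ⊥-elim (≤⇒≯ x≤ (subst (_< _) (sym (+-identityʳ a)) a<x))
∈-climb⁺ a (suc k) {x = x} a≤x x≤ | inj₁ a<x = there (∈-climb⁺ (suc a) k a<x (subst (x ≤_) (+-suc a k) x≤))

∈-climb-tail : ∀ a k {tl x} → x ∈ tl → x ∈ climb a k tl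
∈-climb-tail a zero    x∈ = there x∈
∈-climb-tail a (suc k) x∈ = there (∈-climb-tail (suc a) k x∈)

climb-Linked : ∀ {R : ℕ → ℕ → Set} a k {tl} → (∀ {b} → b < a + k → R b (suc b)) →
  Linked R (a + k ∷ tl) → Linked R (climb a k tl)
climb-Linked {R} a zero    {tl} step l = subst (λ c → Linked R (c ∷ tl)) (+-identityʳ a) l
climb-Linked {R} a (suc k) {tl} step l =
  step (subst (a <_) (sym (+-suc a k)) (s≤s (m≤m+n a k)))
  ∷ climb-Linked (suc a) k (λ {b} b< → step (subst (b <_) (sym (+-suc a k)) b<))
      (subst (λ c → Linked R (c ∷ tl)) (+-suc a k) l)

module TreeModel (q : ℕ) where

  r : ℕ
  r = suc q

  n : ℕ
  n = r + (r + q)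

  data Node : Set where
    nx ny nz : Fin r → Node

  index : Node → ℕ
  index (nx i) = toℕ i
  index (ny j) = r + toℕ j
  index (nz j) = r + (r + toℕ j)

  index≤n : ∀ t → index t ≤ n
  index≤n (nx i) = ≤-trans (s≤s⁻¹ (toℕ<n i)) (≤-trans (m≤n+m q r) (m≤n+m (r + q) r))
  index≤n (ny j) = +-monoʳ-≤ r (≤-trans (s≤s⁻¹ (toℕ<n j)) (m≤n+m q r))
  index≤n (nz j) = +-monoʳ-≤ r (+-monoʳ-≤ r (s≤s⁻¹ (toℕ<n j)))

  toℕ≢r+ : ∀ (i : Fin r) k → toℕ i ≢ r + k
  toℕ≢r+ i k = <⇒≢ (≤-trans (toℕ<n i) (m≤m+n r k))

  index-injective : ∀ s t → index s ≡ index t → s ≡ t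
  index-injective (nx i) (nx i′) eq = cong nx (toℕ-injective eq)
  index-injective (nx i) (ny j)  eq = ⊥-elim (toℕ≢r+ i _ eq)
  index-injective (nx i) (nz j)  eq = ⊥-elim (toℕ≢r+ i _ eq)
  index-injective (ny j) (nx i)  eq = ⊥-elim (toℕ≢r+ i _ (sym eq))
  index-injective (ny j) (ny j′) eq = cong ny (toℕ-injective (+-cancelˡ-≡ r _ _ eq))
  index-injective (ny j) (nz j′) eq = ⊥-elim (toℕ≢r+ j _ (+-cancelˡ-≡ r _ _ eq))
  index-injective (nz j) (nx i)  eq = ⊥-elim (toℕ≢r+ i _ (sym eq))
  index-injective (nz j) (ny j′) eq = ⊥-elim (toℕ≢r+ j′ _ (sym (+-cancelˡ-≡ r _ _ eq)))
  index-injective (nz j) (nz j′) eq =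
    cong nz (toℕ-injective (+-cancelˡ-≡ r _ _ (+-cancelˡ-≡ r _ _ eq)))

  p : ℕ → ℕ
  p v with v <? r
  ... | yes _ = v ∸ 1
  ... | no _ with v <? r + r
  ...   | yes _ = q
  ...   | no _  = v ∸ r

  p<suc : ∀ v → p (suc v) ≤ v
  p<suc v with suc v <? r
  ... | yes _ = ≤-refl
  ... | no v≮r with suc v <? r + r
  ...   | yes _ = s≤s⁻¹ (≮⇒≥ v≮r)
  ...   | no _  = m∸n≤m v q

  p-nx : ∀ a → suc a < r → p (suc a) ≡ a
  p-nx a a<q with suc a <? r
  ... | yes _   = refl
  ... | no a≮q = ⊥-elim (a≮q a<q)

  p-ny : ∀ j → p (index (ny j)) ≡ q
  p-ny j with r + toℕ j <? r
  ... | yes y<r = ⊥-elim (≤⇒≯ (m≤m+n r (toℕ j)) y<r)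
  ... | no _ with r + toℕ j <? r + r
  ...   | yes _   = refl
  ...   | no y≮2r = ⊥-elim (y≮2r (+-monoʳ-< r (toℕ<n j)))

  p-nz : ∀ j → p (index (nz j)) ≡ index (ny j)
  p-nz j with r + (r + toℕ j) <? r
  ... | yes z<r = ⊥-elim (≤⇒≯ (m≤m+n r _) z<r)
  ... | no _ with r + (r + toℕ j) <? r + r
  ...   | yes z<2r = ⊥-elim (≤⇒≯ (+-monoʳ-≤ r (m≤m+n r (toℕ j))) z<2r)
  ...   | no _     = m+n∸m≡n r (r + toℕ j)

module PathModel (q : ℕ) (E : Fin (suc q) → Fin (suc q) → Bool) where

  open TreeModel q
  open Construction r E
  open ParentTree n p p<suc using (ArcChain; ≡p⇒arcℕ)

  Clique : Node → V → Set
  Clique (nx i) = InK i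
  Clique (ny j) = InK' j
  Clique (nz j) = InK'' j

  route : V → List ℕ
  route (X i)     = index (nx i) ∷ []
  route (Y j)     = index (ny j) ∷ []
  route (Z j _)   = index (nz j) ∷ []
  route (A s j _) = climb (toℕ s) (q ∸ toℕ s) (index (ny j) ∷ index (nz j) ∷ [])

  s+[q∸s]≡q : ∀ (s : Fin r) → toℕ s + (q ∸ toℕ s) ≡ q
  s+[q∸s]≡q s = m+[n∸m]≡n (s≤s⁻¹ (toℕ<n s))

  route≢[] : ∀ v → route v ≢ []
  route≢[] (X _)     ()
  route≢[] (Y _)     ()
  route≢[] (Z _ _)   ()
  route≢[] (A _ _ _) ()

  route-chain : ∀ v → ArcChain (route v)
  route-chain (X _)     = [-]
  route-chain (Y _)     = [-]
  route-chain (Z _ _)   = [-]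
  route-chain (A s j _) =
    climb-Linked (toℕ s) (q ∸ toℕ s)
      (λ {b} b<q → ≡p⇒arcℕ (sym (p-nx b (s≤s (subst (b <_) (s+[q∸s]≡q s) b<q)))))
      (subst (λ c → ArcChain (c ∷ index (ny j) ∷ index (nz j) ∷ [])) (sym (s+[q∸s]≡q s))
        (≡p⇒arcℕ (sym (p-ny j)) ∷ ≡p⇒arcℕ (sym (p-nz j)) ∷ [-]))

  ∈route⇒Clique : ∀ {v a} → a ∈ route v → ∃ λ t → a ≡ index t × Clique t v
  ∈route⇒Clique {X i}   (here refl) = nx i , refl , kX
  ∈route⇒Clique {Y j}   (here refl) = ny j , refl , k'Y
  ∈route⇒Clique {Z j d} (here refl) = nz j , refl , k''Z d
  ∈route⇒Clique {A s j e} a∈ with ∈-climb⁻ (toℕ s) (q ∸ toℕ s) a∈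
  ... | inj₁ (s≤a , a≤q) = nx i , sym (toℕ-fromℕ< a<r) , kA s j e (subst (toℕ s ≤_) (sym (toℕ-fromℕ< a<r)) s≤a)
    where
    a<r = s≤s (subst (_ ≤_) (s+[q∸s]≡q s) a≤q)
    i = fromℕ< a<r
  ... | inj₂ (here refl)         = ny j , refl , k'A s e
  ... | inj₂ (there (here refl)) = nz j , refl , k''A s e

  Clique⇒∈route : ∀ t {v} → Clique t v → index t ∈ route v
  Clique⇒∈route (nx i) kX             = here refl
  Clique⇒∈route (nx i) (kA s j e s≤i) =
    ∈-climb⁺ (toℕ s) (q ∸ toℕ s) s≤i (subst (toℕ i ≤_) (sym (s+[q∸s]≡q s)) (s≤s⁻¹ (toℕ<n i)))
  Clique⇒∈route (ny j) k'Y            = here refl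
  Clique⇒∈route (ny j) (k'A i e)      = ∈-climb-tail (toℕ i) (q ∸ toℕ i) (here refl)
  Clique⇒∈route (nz j) (k''Z d)       = here refl
  Clique⇒∈route (nz j) (k''A i e)     = ∈-climb-tail (toℕ i) (q ∸ toℕ i) (there (here refl))

  route-bounded : ∀ v → All (_≤ n) (route v)
  route-bounded v = All.tabulate λ a∈ → bound (∈route⇒Clique a∈)
    where
    bound : ∀ {a} → (∃ λ t → a ≡ index t × Clique t v) → a ≤ n
    bound (t , refl , _) = index≤n t

  Adj⇒Clique : ∀ {u v} → Adj u v → ∃ λ t → Clique t u × Clique t v
  Adj⇒Clique (_ , inj₁ (i , ku , kv))              = nx i , ku , kv
  Adj⇒Clique (_ , inj₂ (inj₁ (j , _ , ku , kv)))   = ny j , ku , kv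
  Adj⇒Clique (_ , inj₂ (inj₂ (j , _ , ku , kv)))   = nz j , ku , kv

  module _ (degN≤3 : ∀ j → degN j ≤ 3) (degN≢1 : ∀ j → degN j ≢ 1) where

    edge⇒degN : ∀ {i j} → T (E i j) → degN j ≡ 2 ⊎ degN j ≡ 3
    edge⇒degN {i} {j} e = two-or-three (degN j) (1≤sum-indicator (λ k → E k j) (∈-allFin i) e) (degN≤3 j) (degN≢1 j)
      where
      two-or-three : ∀ d → 1 ≤ d → d ≤ 3 → d ≢ 1 → d ≡ 2 ⊎ d ≡ 3
      two-or-three 1 _ _ d≢1 = ⊥-elim (d≢1 refl)
      two-or-three 2 _ _ _   = inj₁ refl
      two-or-three 3 _ _ _   = inj₂ refl
      two-or-three (suc (suc (suc (suc _)))) _ (s≤s (s≤s (s≤s ()))) _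

    InK'-degN : ∀ {j u v} → InK' j u → InK' j v → u ≢ v → degN j ≡ 2 ⊎ degN j ≡ 3
    InK'-degN k'Y       k'Y       u≢v = ⊥-elim (u≢v refl)
    InK'-degN k'Y       (k'A i e) _   = edge⇒degN e
    InK'-degN (k'A i e) _         _   = edge⇒degN e

    Clique⇒Adj : ∀ t {u v} → Clique t u → Clique t v → u ≢ v → Adj u v
    Clique⇒Adj (nx i) ku kv u≢v = u≢v , inj₁ (i , ku , kv)
    Clique⇒Adj (ny j) ku kv u≢v = u≢v , inj₂ (inj₁ (j , InK'-degN ku kv u≢v , ku , kv))
    Clique⇒Adj (nz j) (k''Z d) kv u≢v = u≢v , inj₂ (inj₂ (j , ≡ᵇ⇒≡ (degN j) 3 d , k''Z d , kv))
    Clique⇒Adj (nz j) (k''A i e) (k''Z d) u≢v =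
      u≢v , inj₂ (inj₂ (j , ≡ᵇ⇒≡ (degN j) 3 d , k''A i e , k''Z d))
    Clique⇒Adj (nz j) (k''A i e) (k''A i′ e′) u≢v =
      u≢v , inj₂ (inj₁ (j , edge⇒degN e , k'A i e , k'A i′ e′))

    Adj⇔meet : ∀ u v → u ≢ v → Adj u v ⇔ (∃ λ a → a ∈ route u × a ∈ route v)
    Adj⇔meet u v u≢v = mk⇔ Adj⇒meet meet⇒Adj
      where
      Adj⇒meet : Adj u v → ∃ λ a → a ∈ route u × a ∈ route v
      Adj⇒meet adj with Adj⇒Clique adj
      ... | t , ku , kv = index t , Clique⇒∈route t ku , Clique⇒∈route t kv
      meet⇒Adj : (∃ λ a → a ∈ route u × a ∈ route v) → Adj u v
      meet⇒Adj (a , au , av) with ∈route⇒Clique au | ∈route⇒Clique av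
      ... | t , refl , ku | t′ , eq , kv with index-injective t t′ eq
      ... | refl = Clique⇒Adj t ku kv u≢v

lemma2 : (r : ℕ) → (E : Fin r → Fin r → Bool) → 2 ≤ r →
    (∀ i → Construction.degM r E i ≤ 3) → (∀ j → Construction.degN r E j ≤ 3) →
    (∀ i → Construction.degM r E i ≢ 1) → (∀ j → Construction.degN r E j ≢ 1) →
    IsRootedDirectedPathGraph (Construction.V r E) (Construction.Adj r E)
lemma2 (suc q) E _ _ degN≤3 _ degN≢1 =
  isRootedDirectedPathGraph (Construction.Adj (suc q) E) route
    route≢[] route-bounded route-chain (Adj⇔meet degN≤3 degN≢1)
  where
  open TreeModel q
  open ParentTree n p p<suc
  open PathModel q E
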